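{- Let $B$ be a planar brace other than $C_4$. For every $4$-cycle $C$ in $B$ there exists a $4$-cycle $C'$ in $B$ with $E(C)\cap E(C')=\emptyset$.
   Context: A graph is \emph{matching covered} if it is connected and every edge lies in a perfect matching; a cut $\partial(X)$ (edges with exactly one end in $X$) is \emph{tight} if it meets every perfect matching in exactly one edge, and \emph{trivial} if $|X|=1$ or $|V(G)\setminus X|=1$. A \emph{brace} is a bipartite matching covered graph with no non-trivial tight cut (equivalently: $C_4$, or a connected bipartite graph on at least $6$ vertices in which every matching of size at most $2$ extends to a perfect matching). -}

module Defs where

open import Data.Nat using (ℕ; zero; suc; _+_; _*_; _%_; _≡ᵇ_)
open import Data.Bool using (Bool; true; false; _∨_)
open import Data.Fin using (Fin; toℕ)
open import Data.Fin.Subset using (∣_∣)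
open import Data.Vec using (tabulate; sum)
open import Data.List using (List; length)
open import Data.List.Relation.Unary.All using (All)
open import Data.List.Relation.Unary.Any using (Any)
open import Data.List.Relation.Unary.AllPairs using (AllPairs)
open import Data.Product using (Σ; ∃; _×_; _,_)
open import Data.Sum using (_⊎_)
open import Data.Empty using (⊥)
open import Relation.Nullary using (¬_)
open import Relation.Binary.PropositionalEquality using (_≡_; _≢_)
open import Relation.Binary.Construct.Closure.ReflexiveTransitive using (Star)

record Graph : Set where
  field
    n      : ℕ
    adj    : Fin n → Fin n → Bool
    adj-sym    : ∀ u v → adj u v ≡ adj v u
    adj-irrefl : ∀ u → adj u u ≡ false

module _ (G : Graph) where
  open Graph G

  Adj : Fin n → Fin n → Set
  Adj u v = adj u v ≡ true

  Connected : Set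
  Connected = ∀ u v → Star Adj u v

  -- A perfect matching, given as the fixed-point-free involution u ↦ partner of u
  -- (its edges are the pairs {u , mate u}).
  record PerfectMatching : Set where
    field
      mate     : Fin n → Fin n
      mate-inv : ∀ u → mate (mate u) ≡ u
      mate-adj : ∀ u → Adj u (mate u)
  open PerfectMatching public

  MatchingCovered : Set
  MatchingCovered =
    Connected × (∀ u v → Adj u v → Σ PerfectMatching λ M → mate M u ≡ v)

  Bipartite : Set
  Bipartite = Σ (Fin n → Bool) λ c → ∀ u v → Adj u v → c u ≢ c v

  -- X ⊆ V as a characteristic function.  The edge {u , mate u} of M lies in ∂(X)
  -- iff exactly one end is in X; we orient it by its end u in X.
  Crossing : (Fin n → Bool) → PerfectMatching → Fin n → Set
  Crossing X M u = X u ≡ true × X (mate M u) ≡ false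

  TightCut : (Fin n → Bool) → Set
  TightCut X = ∀ (M : PerfectMatching) →
    (Σ (Fin n) λ u → Crossing X M u) ×
    (∀ u u' → Crossing X M u → Crossing X M u' → u ≡ u')

  NonTrivialCut : (Fin n → Bool) → Set
  NonTrivialCut X =
    (Σ (Fin n) λ u → Σ (Fin n) λ u' → u ≢ u' × X u ≡ true × X u' ≡ true) ×
    (Σ (Fin n) λ u → Σ (Fin n) λ u' → u ≢ u' × X u ≡ false × X u' ≡ false)

  Brace : Set
  Brace = Bipartite × MatchingCovered ×
          (∀ (X : Fin n → Bool) → TightCut X → ¬ NonTrivialCut X)

  record Cycle4 : Set where
    field
      a b c d : Fin n
      ab : a ≢ b
      ac : a ≢ c
      ad : a ≢ d
      bc : b ≢ c
      bd : b ≢ d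
      cd : c ≢ d
      e₁ : Adj a b
      e₂ : Adj b c
      e₃ : Adj c d
      e₄ : Adj d a

  EdgeOf : Cycle4 → Fin n → Fin n → Set
  EdgeOf C u v =
    (u ≡ a × v ≡ b) ⊎ (u ≡ b × v ≡ a) ⊎
    (u ≡ b × v ≡ c) ⊎ (u ≡ c × v ≡ b) ⊎
    (u ≡ c × v ≡ d) ⊎ (u ≡ d × v ≡ c) ⊎
    (u ≡ d × v ≡ a) ⊎ (u ≡ a × v ≡ d)
    where open Cycle4 C

  EdgeDisjoint : Cycle4 → Cycle4 → Set
  EdgeDisjoint C C' = ∀ u v → EdgeOf C u v → EdgeOf C' u v → ⊥

c4adj : Fin 4 → Fin 4 → Bool
c4adj i j = ((suc (toℕ i) % 4) ≡ᵇ toℕ j) ∨ ((suc (toℕ j) % 4) ≡ᵇ toℕ i)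

IsC4 : Graph → Set
IsC4 G = Σ (Fin n → Fin 4) λ f → Σ (Fin 4 → Fin n) λ g →
  (∀ u → g (f u) ≡ u) × (∀ i → f (g i) ≡ i) ×
  (∀ u v → adj u v ≡ c4adj (f u) (f v))
  where open Graph G

iter : {A : Set} → (A → A) → ℕ → A → A
iter f zero x = x
iter f (suc k) x = f (iter f k x)

-- Planarity via combinatorial embeddings (rotation systems) and Euler's formula
-- (Heffter–Edmonds–Ringel): a connected graph is planar iff it has a rotation
-- system whose faces satisfy V − E + F = 2.
module _ (G : Graph) where
  open Graph G

  -- number of darts (ordered adjacent pairs) = 2|E|
  nDarts : ℕ
  nDarts = sum (tabulate λ u → ∣ tabulate (adj u) ∣)

  record RotationSystem : Set where
    field
      σ       : Fin n → Fin n → Fin n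
      σ-adj   : ∀ u v → Adj G u v → Adj G u (σ u v)
      σ-inj   : ∀ u v w → Adj G u v → Adj G u w → σ u v ≡ σ u w → v ≡ w
      σ-cycle : ∀ u v w → Adj G u v → Adj G u w → ∃ λ k → iter (σ u) k v ≡ w

    -- face permutation on darts
    φ : Fin n × Fin n → Fin n × Fin n
    φ (u , v) = (v , σ v u)

    SameFace : Fin n × Fin n → Fin n × Fin n → Set
    SameFace x y = ∃ λ k → iter φ k x ≡ y

  Dart : Fin n × Fin n → Set
  Dart (u , v) = Adj G u v

  FaceRepresentatives : RotationSystem → List (Fin n × Fin n) → Set
  FaceRepresentatives ρ reps =
    All Dart reps ×
    (∀ x → Dart x → Any (λ r → SameFace r x) reps) ×
    AllPairs (λ r r' → ¬ SameFace r r') reps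
    where open RotationSystem ρ

  -- (for connected graphs) 2V + 2F = 2E + 4, i.e. V − E + F = 2
  Planar : Set
  Planar = Connected G × Σ RotationSystem λ ρ → Σ (List (Fin n × Fin n)) λ reps →
    FaceRepresentatives ρ reps × (2 * n + 2 * length reps ≡ nDarts + 4)

{-# OPTIONS --safe #-}
-- A brace B ≠ C₄ has at least five vertices and therefore minimum degree three: if v had a
-- single neighbour y, every perfect matching would match v to y, so {v, y} would be a connected
-- component; if v had exactly two neighbours y and z, then ∂{v, y, z} would be a non-trivial
-- tight cut.  In a planar embedding every face of B has length 4 or at least 6 (B is bipartite
-- and the rotation has no fixed points), so counting min(|f|, 6) darts per face and Euler's
-- formula give at least 6 + T quadrangular faces, where T = Σ (deg x − 3) over the corners x
-- of C.  A quadrangle sharing an edge with C contains one of the eight darts of C, and at a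
-- corner of degree three the two edges of C are consecutive in the rotation, so two of these
-- darts lie on a common face.  Hence at most 5 + T quadrangles share an edge with C, and some
-- quadrangular face is a 4-cycle edge-disjoint from C.

module Submission where

open import Defs
open import Data.Product using (Σ)
open import Relation.Nullary using (¬_)

open import Data.Bool as Bool using (Bool; true; false; not; if_then_else_)
open import Data.Bool.Properties using (¬-not)
open import Data.Empty using (⊥; ⊥-elim)
open import Data.Fin as Fin using (Fin; zero; suc; toℕ; combine)
open import Data.Fin.Patterns using (0F; 1F; 2F; 3F)
open import Data.Fin.Properties using (pigeonhole; combine-injective; ¬∀⟶∃¬; any?)
open import Data.Fin.Subset using (∣_∣)
open import Data.List as List using (List; []; _∷_; _++_; length; map; concat; concatMap; filter; applyUpTo; allFin)
open import Data.List.Membership.Propositional using (_∈_; _∉_; find; lose)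
open import Data.List.Membership.Propositional.Properties
  using (∈-map⁺; ∈-lookup; ∈-concat⁺′; ∈-tabulate⁺; ∈-allFin; ∈-applyUpTo⁻; ∈-concatMap⁻)
open import Data.List.Properties using (length-++; length-map; length-removeAt′; map-tabulate; length-applyUpTo)
open import Data.List.Relation.Unary.All as All using (All; []; _∷_)
open import Data.List.Relation.Unary.All.Properties as All using (¬All⇒Any¬; ¬Any⇒All¬)
open import Data.List.Relation.Unary.AllPairs as AllPairs using (AllPairs; []; _∷_)
open import Data.List.Relation.Unary.AllPairs.Properties as AllPairs using ()
open import Data.List.Relation.Unary.Any as Any using (Any; here; there; _─_; index)
open import Data.List.Relation.Unary.Any.Properties using (lookup-index)
open import Data.List.Relation.Unary.Unique.Propositional using (Unique)
open import Data.List.Relation.Unary.Unique.Propositional.Properties as Unique using (applyUpTo⁺₁)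
open import Data.Nat using (ℕ; zero; suc; _+_; _*_; _∸_; _≤_; _<_; z≤n; s≤s; _≤?_)
open import Data.Nat.ListAction using (sum)
open import Data.Nat.Properties
open import Algebra.Properties.CommutativeSemigroup +-commutativeSemigroup using (x∙yz≈y∙xz)
open import Data.Nat.Tactic.RingSolver using (solve-∀)
open import Data.Product as Product using (∃; _×_; _,_; _,′_; proj₁; proj₂; uncurry)
open import Data.Product.Properties using (≡-dec)
open import Data.Sum as Sum using (_⊎_; inj₁; inj₂)
import Data.Vec as Vec
import Data.Vec.Properties as Vec
open import Function using (_∘_; id; case_of_)
open import Relation.Binary.Construct.Closure.ReflexiveTransitive using (Star; ε; _◅_)
open import Relation.Binary.Definitions using (DecidableEquality)
open import Relation.Binary.PropositionalEquality
open import Relation.Nullary using (Dec; yes; no; does; ¬?)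
open import Relation.Nullary.Decidable using (_×-dec_; _⊎-dec_; dec-true; dec-false; decidable-stable)

private variable
  A B : Set
  x : A
  xs ys : List A
  P Q : A → Set

Any-─ : (p : Any P ys) → Any Q ys → (∀ {y} → P y → Q y → ⊥) → Any Q (ys ─ p)
Any-─ (here py) (here qy) disjoint = ⊥-elim (disjoint py qy)
Any-─ (here _)  (there q) _        = q
Any-─ (there _) (here qy) _        = here qy
Any-─ (there p) (there q) disjoint = there (Any-─ p q disjoint)

length≤-disjoint-witnesses : {W : A → B → Set} {xs : List A} {ys : List B} →
  AllPairs (λ x x′ → ∀ {y} → W x y → W x′ y → ⊥) xs →
  All (λ x → Any (W x) ys) xs → length xs ≤ length ys
length≤-disjoint-witnesses [] [] = z≤n
length≤-disjoint-witnesses {ys = ys} (disjoint ∷ disjoints) (hit ∷ hits) = begin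
  suc _                   ≤⟨ s≤s (length≤-disjoint-witnesses disjoints
                                   (All.zipWith (λ (d , h) → Any-─ hit h λ w w′ → d w w′) (disjoint , hits))) ⟩
  suc (length (ys ─ hit)) ≡⟨ length-removeAt′ ys (index hit) ⟨
  length ys               ∎
  where open ≤-Reasoning

length-mono-⊆ : Unique xs → (∀ {x} → x ∈ xs → x ∈ ys) → length xs ≤ length ys
length-mono-⊆ unique ⊆ =
  length≤-disjoint-witnesses (AllPairs.map (λ x≢x′ {_} x≡y x′≡y → x≢x′ (trans x≡y (sym x′≡y))) unique)
                             (All.tabulate ⊆)

AllPairs-mapWith-All : {R S : A → A → Set} → (∀ {x y} → P x → P y → R x y → S x y) →
                       All P xs → AllPairs R xs → AllPairs S xs
AllPairs-mapWith-All f []         []         = []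
AllPairs-mapWith-All f (px ∷ pxs) (rx ∷ rxs) =
  All.zipWith (λ (py , rxy) → f px py rxy) (pxs , rx) ∷ AllPairs-mapWith-All f pxs rxs

length-filter-∁ : (P? : ∀ x → Dec (P x)) (xs : List A) →
                  length (filter P? xs) + length (filter (¬? ∘ P?) xs) ≡ length xs
length-filter-∁ P? []       = refl
length-filter-∁ P? (x ∷ xs) with P? x
... | yes _ = cong suc (length-filter-∁ P? xs)
... | no _  = trans (+-suc _ _) (cong suc (length-filter-∁ P? xs))

sum-map-─ : (g : A → ℕ) (p : x ∈ ys) → sum (map g ys) ≡ g x + sum (map g (ys ─ p))
sum-map-─ g (here refl) = refl
sum-map-─ {x = x} {ys = y ∷ _} g (there p) = trans (cong (g y +_) (sum-map-─ g p)) (x∙yz≈y∙xz (g y) (g x) _)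

sum-mono-⊆ : (g : A → ℕ) → Unique xs → (∀ {x} → x ∈ xs → x ∈ ys) → sum (map g xs) ≤ sum (map g ys)
sum-mono-⊆ g [] _ = z≤n
sum-mono-⊆ {xs = x ∷ xs} {ys} g (x∉xs ∷ unique) ⊆ = begin
  g x + sum (map g xs)          ≤⟨ +-monoʳ-≤ (g x) (sum-mono-⊆ g unique ⊆-rest) ⟩
  g x + sum (map g (ys ─ x∈ys)) ≡⟨ sum-map-─ g x∈ys ⟨
  sum (map g ys)                ∎
  where
  open ≤-Reasoning
  x∈ys = ⊆ (here refl)
  ⊆-rest : ∀ {x′} → x′ ∈ xs → x′ ∈ (ys ─ x∈ys)
  ⊆-rest x′∈xs = Any-─ x∈ys (⊆ (there x′∈xs)) λ x≡y x′≡y → All.lookup x∉xs x′∈xs (trans x≡y (sym x′≡y))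

module _ (_≟_ : DecidableEquality A) where
  open import Data.List.Membership.DecPropositional _≟_ using (_∈?_)

  ∃-∉ : {xs ys : List A} → Unique xs → length ys < length xs → ∃ (_∉ ys)
  ∃-∉ {xs = xs} {ys = ys} unique shorter with All.all? (_∈? ys) xs
  ... | yes all∈ = ⊥-elim (<⇒≱ shorter (length-mono-⊆ unique (All.lookup all∈)))
  ... | no ¬all∈ = let x , _ , x∉ys = find (¬All⇒Any¬ (_∈? ys) xs ¬all∈) in x , x∉ys

lookup-injective : Unique xs → ∀ {i j} → List.lookup xs i ≡ List.lookup xs j → i ≡ j
lookup-injective (_ ∷ _)    {zero}  {zero}  _  = refl
lookup-injective (x∉xs ∷ _) {zero}  {suc j} eq = ⊥-elim (All.lookup x∉xs (∈-lookup j) eq)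
lookup-injective (x∉xs ∷ _) {suc i} {zero}  eq = ⊥-elim (All.lookup x∉xs (∈-lookup i) (sym eq))
lookup-injective (_ ∷ unique) {suc i} {suc j} eq = cong suc (lookup-injective unique eq)

members : ∀ {n} → (Fin n → Bool) → List (Fin n)
members {zero}  p = []
members {suc n} p = if p zero then zero ∷ rest else rest
  where rest = map suc (members (p ∘ suc))

length-members : ∀ {n} (p : Fin n → Bool) → length (members p) ≡ ∣ Vec.tabulate p ∣
length-members {zero}  p = refl
length-members {suc n} p with p zero
... | true  = cong suc (trans (length-map suc (members (p ∘ suc))) (length-members (p ∘ suc)))
... | false = trans (length-map suc (members (p ∘ suc))) (length-members (p ∘ suc))

∈-members : ∀ {n} (p : Fin n → Bool) {i} → p i ≡ true → i ∈ members p
∈-members {suc n} p {zero}  pi with p zero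
∈-members {suc n} p {zero}  refl | true = here refl
∈-members {suc n} p {suc i} pi with p zero
... | true  = there (∈-map⁺ suc (∈-members (p ∘ suc) pi))
... | false = ∈-map⁺ suc (∈-members (p ∘ suc) pi)

sum-tabulate : ∀ {n} (f : Fin n → ℕ) → sum (List.tabulate f) ≡ Vec.sum (Vec.tabulate f)
sum-tabulate {zero}  f = refl
sum-tabulate {suc n} f = cong (f zero +_) (sum-tabulate (f ∘ suc))

sum-tabulate-+ : ∀ {n} k (f : Fin n → ℕ) →
                 Vec.sum (Vec.tabulate (λ i → k + f i)) ≡ n * k + Vec.sum (Vec.tabulate f)
sum-tabulate-+ {zero}  k f = refl
sum-tabulate-+ {suc n} k f = begin
  k + f zero + Vec.sum (Vec.tabulate (λ i → k + f (suc i))) ≡⟨ cong (k + f zero +_) (sum-tabulate-+ k (f ∘ suc)) ⟩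
  k + f zero + (n * k + Vec.sum (Vec.tabulate (f ∘ suc)))   ≡⟨ shuffle k (f zero) (n * k) _ ⟩
  k + n * k + (f zero + Vec.sum (Vec.tabulate (f ∘ suc)))   ∎
  where
  open ≡-Reasoning
  shuffle : ∀ a b c d → a + b + (c + d) ≡ a + c + (b + d)
  shuffle = solve-∀

length-concat-tabulate : ∀ {n} (h : Fin n → List A) →
                         length (concat (List.tabulate h)) ≡ Vec.sum (Vec.tabulate (length ∘ h))
length-concat-tabulate {n = zero}  h = refl
length-concat-tabulate {n = suc n} h =
  trans (length-++ (h zero)) (cong (length (h zero) +_) (length-concat-tabulate (h ∘ suc)))

iter-+ : (f : A → A) (m k : ℕ) (x : A) → iter f (m + k) x ≡ iter f m (iter f k x)
iter-+ f zero    k x = refl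
iter-+ f (suc m) k x = cong f (iter-+ f m k x)

iter-comm : (f : A → A) (m k : ℕ) (x : A) → iter f m (iter f k x) ≡ iter f k (iter f m x)
iter-comm f m k x = begin
  iter f m (iter f k x) ≡⟨ iter-+ f m k x ⟨
  iter f (m + k) x      ≡⟨ cong (λ j → iter f j x) (+-comm m k) ⟩
  iter f (k + m) x      ≡⟨ iter-+ f k m x ⟩
  iter f k (iter f m x) ∎
  where open ≡-Reasoning

iter-fixed : (f : A → A) → f x ≡ x → ∀ k → iter f k x ≡ x
iter-fixed f fx≡x zero    = refl
iter-fixed f fx≡x (suc k) = trans (cong f (iter-fixed f fx≡x k)) fx≡x

iter-period : (f : A → A) (p : ℕ) → iter f p x ≡ x → ∀ k → iter f (k * p) x ≡ x
iter-period f p periodic zero    = refl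
iter-period {x = x} f p periodic (suc k) = begin
  iter f (p + k * p) x      ≡⟨ iter-+ f p (k * p) x ⟩
  iter f p (iter f (k * p) x) ≡⟨ cong (iter f p) (iter-period f p periodic k) ⟩
  iter f p x                ≡⟨ periodic ⟩
  x                         ∎
  where open ≡-Reasoning

-- Degrees and darts

module GraphProperties (G : Graph) where
  open Graph G

  Adj-sym : ∀ {u v} → Adj G u v → Adj G v u
  Adj-sym {u} {v} uv = trans (adj-sym v u) uv

  Adj⇒≢ : ∀ {u v} → Adj G u v → u ≢ v
  Adj⇒≢ {u} uv refl with () ← trans (sym uv) (adj-irrefl u)

  adj? : ∀ u v → Dec (Adj G u v)
  adj? u v = adj u v Bool.≟ true

  neighbours : Fin n → List (Fin n)
  neighbours u = members (adj u)

  degree : Fin n → ℕ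
  degree u = ∣ Vec.tabulate (adj u) ∣

  excess : Fin n → ℕ
  excess u = degree u ∸ 3

  distinct-neighbours≤degree : ∀ {v ws} → Unique ws → All (Adj G v) ws → length ws ≤ degree v
  distinct-neighbours≤degree {v} unique adjacent =
    subst (_ ≤_) (length-members (adj v)) (length-mono-⊆ unique (∈-members (adj v) ∘ All.lookup adjacent))

  darts : List (Fin n × Fin n)
  darts = concat (List.tabulate λ u → map (u ,_) (neighbours u))

  length-darts : length darts ≡ nDarts G
  length-darts = trans (length-concat-tabulate (λ u → map (u ,_) (neighbours u)))
    (cong Vec.sum (Vec.tabulate-cong λ u → trans (length-map (u ,_) (neighbours u)) (length-members (adj u))))

  darts-complete : ∀ {x} → Dart G x → x ∈ darts
  darts-complete {u , v} uv = ∈-concat⁺′ (∈-map⁺ (u ,_) (∈-members (adj u) uv)) (∈-tabulate⁺ u)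

  degree-sum : (∀ v → 3 ≤ degree v) → ∀ {xs} → Unique xs → 3 * n + sum (map excess xs) ≤ nDarts G
  degree-sum 3≤degree {xs} unique = begin
    3 * n + sum (map excess xs)
      ≤⟨ +-monoʳ-≤ (3 * n) (sum-mono-⊆ excess unique λ {u} _ → ∈-allFin u) ⟩
    3 * n + sum (map excess (allFin n))
      ≡⟨ cong (3 * n +_) (trans (cong sum (map-tabulate id excess)) (sum-tabulate excess)) ⟩
    3 * n + Vec.sum (Vec.tabulate excess)
      ≡⟨ cong (_+ Vec.sum (Vec.tabulate excess)) (*-comm 3 n) ⟩
    n * 3 + Vec.sum (Vec.tabulate excess)
      ≡⟨ sum-tabulate-+ 3 excess ⟨
    Vec.sum (Vec.tabulate (λ u → 3 + excess u))
      ≡⟨ cong Vec.sum (Vec.tabulate-cong λ u → m+[n∸m]≡n (3≤degree u)) ⟩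
    nDarts G ∎
    where open ≤-Reasoning

  module _ (C : Cycle4 G) where
    open Cycle4 C

    corners : List (Fin n)
    corners = a ∷ b ∷ c ∷ d ∷ []

    corners-unique : Unique corners
    corners-unique = (ab ∷ ac ∷ ad ∷ []) ∷ (bc ∷ bd ∷ []) ∷ (cd ∷ []) ∷ [] ∷ []

    forwardDarts backwardDarts : List (Fin n × Fin n)
    forwardDarts  = (a , b) ∷ (b , c) ∷ (c , d) ∷ (d , a) ∷ []
    backwardDarts = (b , a) ∷ (a , d) ∷ (d , c) ∷ (c , b) ∷ []

    forwardDarts-darts : All (Dart G) forwardDarts
    forwardDarts-darts = e₁ ∷ e₂ ∷ e₃ ∷ e₄ ∷ []

    backwardDarts-darts : All (Dart G) backwardDarts
    backwardDarts-darts = Adj-sym e₁ ∷ Adj-sym e₄ ∷ Adj-sym e₃ ∷ Adj-sym e₂ ∷ []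

    EdgeOf⇒dart : ∀ {u v} → EdgeOf G C u v → (u , v) ∈ forwardDarts ⊎ (u , v) ∈ backwardDarts
    EdgeOf⇒dart (inj₁ (refl , refl))                                                 = inj₁ (here refl)
    EdgeOf⇒dart (inj₂ (inj₁ (refl , refl)))                                          = inj₂ (here refl)
    EdgeOf⇒dart (inj₂ (inj₂ (inj₁ (refl , refl))))                                   = inj₁ (there (here refl))
    EdgeOf⇒dart (inj₂ (inj₂ (inj₂ (inj₁ (refl , refl)))))                            = inj₂ (there (there (there (here refl))))
    EdgeOf⇒dart (inj₂ (inj₂ (inj₂ (inj₂ (inj₁ (refl , refl))))))                     = inj₁ (there (there (here refl)))
    EdgeOf⇒dart (inj₂ (inj₂ (inj₂ (inj₂ (inj₂ (inj₁ (refl , refl)))))))              = inj₂ (there (there (here refl)))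
    EdgeOf⇒dart (inj₂ (inj₂ (inj₂ (inj₂ (inj₂ (inj₂ (inj₁ (refl , refl))))))))       = inj₁ (there (there (there (here refl))))
    EdgeOf⇒dart (inj₂ (inj₂ (inj₂ (inj₂ (inj₂ (inj₂ (inj₂ (refl , refl))))))))       = inj₂ (there (here refl))

    reverse-forwardDart : ∀ {u v} → (u , v) ∈ forwardDarts → (v , u) ∈ backwardDarts
    reverse-forwardDart (here refl)                         = here refl
    reverse-forwardDart (there (here refl))                 = there (there (there (here refl)))
    reverse-forwardDart (there (there (here refl)))         = there (there (here refl))
    reverse-forwardDart (there (there (there (here refl)))) = there (here refl)

    reverse-backwardDart : ∀ {u v} → (u , v) ∈ backwardDarts → (v , u) ∈ forwardDarts
    reverse-backwardDart (here refl)                         = here refl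
    reverse-backwardDart (there (here refl))                 = there (there (there (here refl)))
    reverse-backwardDart (there (there (here refl)))         = there (there (here refl))
    reverse-backwardDart (there (there (there (here refl)))) = there (here refl)

-- Braces other than C₄

AtLeastFiveVertices : Graph → Set
AtLeastFiveVertices G = ∀ (S : List (Fin (Graph.n G))) → length S ≤ 4 → ∃ (_∉ S)

module _ {G : Graph} (bipartite : Bipartite G) (C : Cycle4 G) where
  open Graph G
  open GraphProperties G
  open Cycle4 C

  private
    colour = proj₁ bipartite

    same-colour : ∀ {u v w} → Adj G u v → Adj G w v → colour u ≡ colour w
    same-colour {u} {v} {w} uv wv = trans (¬-not (proj₂ bipartite u v uv)) (sym (¬-not (proj₂ bipartite w v wv)))

    non-adjacent : ∀ {u w} → colour u ≡ colour w → adj u w ≡ false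
    non-adjacent {u} {w} same = ¬-not λ uw → proj₂ bipartite u w uw same

    corner : Fin 4 → Fin n
    corner = List.lookup (corners C)

    corner-adjacency : ∀ i j → adj (corner i) (corner j) ≡ c4adj i j
    corner-adjacency 0F 0F = adj-irrefl a
    corner-adjacency 0F 1F = e₁
    corner-adjacency 0F 2F = non-adjacent (same-colour e₁ (Adj-sym e₂))
    corner-adjacency 0F 3F = Adj-sym e₄
    corner-adjacency 1F 0F = Adj-sym e₁
    corner-adjacency 1F 1F = adj-irrefl b
    corner-adjacency 1F 2F = e₂
    corner-adjacency 1F 3F = non-adjacent (same-colour e₂ (Adj-sym e₃))
    corner-adjacency 2F 0F = non-adjacent (same-colour (Adj-sym e₂) e₁)
    corner-adjacency 2F 1F = Adj-sym e₂
    corner-adjacency 2F 2F = adj-irrefl c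
    corner-adjacency 2F 3F = e₃
    corner-adjacency 3F 0F = e₄
    corner-adjacency 3F 1F = non-adjacent (same-colour (Adj-sym e₃) e₂)
    corner-adjacency 3F 2F = Adj-sym e₃
    corner-adjacency 3F 3F = adj-irrefl d

  corners-cover⇒IsC4 : (∀ u → u ∈ corners C) → IsC4 G
  corners-cover⇒IsC4 cover = position , corner , corner∘position , position∘corner , adjacency
    where
    position : Fin n → Fin 4
    position u = index (cover u)

    corner∘position : ∀ u → corner (position u) ≡ u
    corner∘position u = sym (lookup-index (cover u))

    position∘corner : ∀ i → position (corner i) ≡ i
    position∘corner i = lookup-injective (corners-unique C) (corner∘position (corner i))

    adjacency : ∀ u v → adj u v ≡ c4adj (position u) (position v)
    adjacency u v = subst₂ (λ u′ v′ → adj u′ v′ ≡ c4adj (position u) (position v))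
      (corner∘position u) (corner∘position v) (corner-adjacency (position u) (position v))

  ¬IsC4⇒atLeastFiveVertices : ¬ IsC4 G → AtLeastFiveVertices G
  ¬IsC4⇒atLeastFiveVertices notC4 S |S|≤4 = ∃-∉ Fin._≟_ (fifth∉corners ∷ corners-unique C) (s≤s |S|≤4)
    where
    open import Data.List.Membership.DecPropositional (Fin._≟_ {n}) using (_∈?_)
    fifth = ¬∀⟶∃¬ n (_∈ corners C) (_∈? corners C) (notC4 ∘ corners-cover⇒IsC4)
    fifth∉corners : All (proj₁ fifth ≢_) (corners C)
    fifth∉corners = All.tabulate λ x∈ fifth≡x → proj₂ fifth (subst (_∈ corners C) (sym fifth≡x) x∈)

MinDegree≥3 : Graph → Set
MinDegree≥3 G = (∀ v → ∃ (Adj G v)) × (∀ {v y z} → Adj G v y → Adj G v z → ∃ λ w → Adj G v w × w ≢ y × w ≢ z)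

module _ {G : Graph} (matchingCovered : MatchingCovered G) (tight : ∀ X → TightCut G X → ¬ NonTrivialCut G X)
         (more : AtLeastFiveVertices G) where
  open Graph G
  open GraphProperties G
  open import Data.List.Membership.DecPropositional (Fin._≟_ {n}) using (_∈?_)

  private
    connected = proj₁ matchingCovered
    matchable = proj₂ matchingCovered

    mate-swap : ∀ (M : PerfectMatching G) {u w} → mate M u ≡ w → mate M w ≡ u
    mate-swap M {u} refl = mate-inv M u

    reachable-closed : ∀ {P : Fin n → Set} → (∀ {u w} → P u → Adj G u w → P w) →
                       ∀ {u w} → Star (Adj G) u w → P u → P w
    reachable-closed step ε             pu = pu
    reachable-closed step (uw ◅ path) pu = reachable-closed step path (step pu uw)

    no-single-neighbour : ∀ {v y} → Adj G v y → (∀ w → Adj G v w → w ≡ y) → ⊥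
    no-single-neighbour {v} {y} vy only =
      let u , u∉ = more (v ∷ y ∷ []) (s≤s (s≤s z≤n)) in
      u∉ (reachable-closed step (connected v u) (here refl))
      where
      step : ∀ {u w} → u ∈ v ∷ y ∷ [] → Adj G u w → w ∈ v ∷ y ∷ []
      step (here refl)         vw = there (here (only _ vw))
      step (there (here refl)) yw =
        let M , y↦w = matchable y _ yw in here (trans (sym y↦w) (mate-swap M (only _ (mate-adj M v))))

    module _ {v y z} (vy : Adj G v y) (vz : Adj G v z) (y≢z : y ≢ z)
             (only : ∀ w → Adj G v w → w ≡ y ⊎ w ≡ z) where
      S : List (Fin n)
      S = v ∷ y ∷ z ∷ []

      X : Fin n → Bool
      X w = does (w ∈? S)

      X-∈ : ∀ {w} → w ∈ S → X w ≡ true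
      X-∈ {w} = dec-true (w ∈? S)

      X-∉ : ∀ {w} → w ∉ S → X w ≡ false
      X-∉ {w} = dec-false (w ∈? S)

      X⇒∈ : ∀ {w} → X w ≡ true → w ∈ S
      X⇒∈ {w} Xw = decidable-stable (w ∈? S) λ w∉S → case trans (sym Xw) (X-∉ w∉S) of λ ()

      S-cases : ∀ {w} → w ∈ S → w ≡ v ⊎ w ≡ y ⊎ w ≡ z
      S-cases (here w≡v)                 = inj₁ w≡v
      S-cases (there (here w≡y))         = inj₂ (inj₁ w≡y)
      S-cases (there (there (here w≡z))) = inj₂ (inj₂ w≡z)

      -- A perfect matching matches v inside S, say to p; then only the edge at q leaves S.
      crossing-once : ∀ {p q} → (∀ {w} → w ∈ S → w ≡ v ⊎ w ≡ p ⊎ w ≡ q) → p ∈ S → q ∈ S → p ≢ q → q ≢ v →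
        ∀ M → mate M v ≡ p →
        Σ (Fin n) (Crossing G X M) × (∀ u u′ → Crossing G X M u → Crossing G X M u′ → u ≡ u′)
      crossing-once {p} {q} cases p∈S q∈S p≢q q≢v M v↦p =
        (q , crossing-q) , λ _ _ cu cu′ → trans (at-q cu) (sym (at-q cu′))
        where
        crossing-q : Crossing G X M q
        crossing-q = X-∈ q∈S , X-∉ λ mq∈S → case cases mq∈S of λ where
          (inj₁ q↦v)         → p≢q (trans (sym v↦p) (mate-swap M q↦v))
          (inj₂ (inj₁ q↦p))  → q≢v (trans (sym (mate-swap M q↦p)) (mate-swap M v↦p))
          (inj₂ (inj₂ q↦q))  → Adj⇒≢ (mate-adj M q) (sym q↦q)
        at-q : ∀ {u} → Crossing G X M u → u ≡ q
        at-q {u} (Xu , Xmu) with cases (X⇒∈ {u} Xu)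
        ... | inj₁ refl        with () ← trans (sym Xmu) (trans (cong X v↦p) (X-∈ p∈S))
        ... | inj₂ (inj₁ refl) with () ← trans (sym Xmu) (trans (cong X (mate-swap M v↦p)) (X-∈ (here refl)))
        ... | inj₂ (inj₂ u≡q)  = u≡q

      tight-cut : TightCut G X
      tight-cut M with only (mate M v) (mate-adj M v)
      ... | inj₁ v↦y = crossing-once S-cases (there (here refl)) (there (there (here refl)))
                         y≢z (Adj⇒≢ vz ∘ sym) M v↦y
      ... | inj₂ v↦z = crossing-once (Sum.map₂ Sum.swap ∘ S-cases) (there (there (here refl))) (there (here refl))
                         (y≢z ∘ sym) (Adj⇒≢ vy ∘ sym) M v↦z

      non-trivial : NonTrivialCut G X
      non-trivial =
        let u₁ , u₁∉S = more S (s≤s (s≤s (s≤s z≤n)))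
            u₂ , u₂∉  = more (u₁ ∷ S) (s≤s (s≤s (s≤s (s≤s z≤n))))
        in (v , y , Adj⇒≢ vy , X-∈ (here refl) , X-∈ (there (here refl))) ,
           (u₁ , u₂ , (λ u₁≡u₂ → u₂∉ (here (sym u₁≡u₂))) , X-∉ u₁∉S , X-∉ (u₂∉ ∘ there))

      no-two-neighbours : ⊥
      no-two-neighbours = tight X tight-cut non-trivial

  brace⇒minDegree≥3 : MinDegree≥3 G
  brace⇒minDegree≥3 = neighbour , third
    where
    neighbour : ∀ v → ∃ (Adj G v)
    neighbour v with more (v ∷ []) (s≤s z≤n)
    ... | u , u∉ with connected v u
    ...   | ε      = ⊥-elim (u∉ (here refl))
    ...   | vw ◅ _ = _ , vw

    third : ∀ {v y z} → Adj G v y → Adj G v z → ∃ λ w → Adj G v w × w ≢ y × w ≢ z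
    third {v} {y} {z} vy vz with any? (λ w → adj? v w ×-dec (¬? (w Fin.≟ y) ×-dec ¬? (w Fin.≟ z)))
    ... | yes found = found
    ... | no none with y Fin.≟ z
    ...   | yes refl = ⊥-elim (no-single-neighbour vy λ w vw →
                         decidable-stable (w Fin.≟ y) λ w≢y → none (w , vw , w≢y , w≢y))
    ...   | no y≢z   = ⊥-elim (no-two-neighbours vy vz y≢z only)
      where
      only : ∀ w → Adj G v w → w ≡ y ⊎ w ≡ z
      only w vw with w Fin.≟ y | w Fin.≟ z
      ... | yes w≡y | _       = inj₁ w≡y
      ... | no _    | yes w≡z = inj₂ w≡z
      ... | no w≢y  | no w≢z  = ⊥-elim (none (w , vw , w≢y , w≢z))

-- Faces

module RotationSystemProperties {G : Graph} (ρ : RotationSystem G) where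
  open Graph G
  open GraphProperties G
  open RotationSystem ρ

  _≟ᵈ_ : DecidableEquality (Fin n × Fin n)
  _≟ᵈ_ = ≡-dec Fin._≟_ Fin._≟_

  φ-dart : ∀ {x} → Dart G x → Dart G (φ x)
  φ-dart {u , v} uv = σ-adj v u (Adj-sym uv)

  iter-dart : ∀ k {x} → Dart G x → Dart G (iter φ k x)
  iter-dart zero    dx = dx
  iter-dart (suc k) dx = φ-dart (iter-dart k dx)

  φ-injective : ∀ {x y} → Dart G x → Dart G y → φ x ≡ φ y → x ≡ y
  φ-injective {u , v} {u′ , v′} uv u′v′ eq with refl ← cong proj₁ eq =
    cong (_, v) (σ-inj v u u′ (Adj-sym uv) (Adj-sym u′v′) (cong proj₂ eq))

  iter-injective : ∀ k {x y} → Dart G x → Dart G y → iter φ k x ≡ iter φ k y → x ≡ y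
  iter-injective zero    dx dy eq = eq
  iter-injective (suc k) dx dy eq = iter-injective k dx dy (φ-injective (iter-dart k dx) (iter-dart k dy) eq)

  iterate-cancel : ∀ j d {r r′} → Dart G r → Dart G r′ → iter φ (j + d) r ≡ iter φ j r′ → iter φ d r ≡ r′
  iterate-cancel j d {r} dr dr′ eq = iter-injective j (iter-dart d dr) dr′ (trans (sym (iter-+ φ j d r)) eq)

  periodic : ∀ {x} → Dart G x → ∃ λ p → iter φ (suc p) x ≡ x
  periodic {x} dx
    with i , j , i<j , same ← pigeonhole (n<1+n (n * n)) (λ k → uncurry combine (iter φ (toℕ k) x))
    with p , i+1+p≡j ← m≤n⇒∃[o]m+o≡n i<j
    = p , iterate-cancel (toℕ i) (suc p) dx dx (begin
      iter φ (toℕ i + suc p) x ≡⟨ cong (λ m → iter φ m x) (trans (+-suc (toℕ i) p) i+1+p≡j) ⟩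
      iter φ (toℕ j) x         ≡⟨ uncurry (cong₂ _,_) (combine-injective _ _ _ _ same) ⟨
      iter φ (toℕ i) x         ∎)
    where open ≡-Reasoning

  SameFace-sym : ∀ {x y} → Dart G x → SameFace x y → SameFace y x
  SameFace-sym {x} dx (k , refl) = k * p , (begin
    iter φ (k * p) (iter φ k x) ≡⟨ iter-+ φ (k * p) k x ⟨
    iter φ (k * p + k) x        ≡⟨ cong (λ m → iter φ m x) (trans (+-comm (k * p) k) (sym (*-suc k p))) ⟩
    iter φ (k * suc p) x        ≡⟨ iter-period φ (suc p) (proj₂ (periodic dx)) k ⟩
    x                           ∎)
    where
    open ≡-Reasoning
    p = proj₁ (periodic dx)

  iterates-meet : ∀ i j {r r′} → Dart G r → Dart G r′ → iter φ i r ≡ iter φ j r′ → SameFace r r′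
  iterates-meet i j {r} {r′} dr dr′ eq with ≤-total j i
  ... | inj₁ j≤i = let d , j+d≡i = m≤n⇒∃[o]m+o≡n j≤i in
    d , iterate-cancel j d dr dr′ (subst (λ m → iter φ m r ≡ iter φ j r′) (sym j+d≡i) eq)
  ... | inj₂ i≤j = let d , i+d≡j = m≤n⇒∃[o]m+o≡n i≤j in
    SameFace-sym dr′ (d , iterate-cancel i d dr′ dr (subst (λ m → iter φ m r′ ≡ iter φ i r) (sym i+d≡j) (sym eq)))

  DistinctFaces : List (Fin n × Fin n) → Set
  DistinctFaces = AllPairs (λ r r′ → ¬ SameFace r r′)

  orbitPrefix : ℕ → Fin n × Fin n → List (Fin n × Fin n)
  orbitPrefix k r = applyUpTo (λ i → iter φ i r) k

  length-orbitPrefix : ∀ k r → length (orbitPrefix k r) ≡ k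
  length-orbitPrefix k r = length-applyUpTo (λ i → iter φ i r) k

  orbitPrefix-darts : ∀ {k r x} → Dart G r → x ∈ orbitPrefix k r → Dart G x
  orbitPrefix-darts dr x∈ with i , _ , refl ← ∈-applyUpTo⁻ _ x∈ = iter-dart i dr

  orbitPrefixes-meet : ∀ {k k′ r r′ x} → Dart G r → Dart G r′ →
                       x ∈ orbitPrefix k r → x ∈ orbitPrefix k′ r′ → SameFace r r′
  orbitPrefixes-meet dr dr′ x∈ x∈′ with i , _ , refl ← ∈-applyUpTo⁻ _ x∈ | j , _ , eq ← ∈-applyUpTo⁻ _ x∈′ =
    iterates-meet i j dr dr′ eq

  Quadrangular : Fin n × Fin n → Set
  Quadrangular r = iter φ 4 r ≡ r

  quadrangular? : ∀ r → Dec (Quadrangular r)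
  quadrangular? r = iter φ 4 r ≟ᵈ r

  quadrangular-backwards : ∀ i {r} → Dart G r → Quadrangular (iter φ i r) → Quadrangular r
  quadrangular-backwards i {r} dr q = iter-injective i (iter-dart 4 dr) dr (trans (iter-comm φ i 4 r) q)

  QuadrangularFace : Fin n × Fin n → Set
  QuadrangularFace r = Dart G r × Quadrangular r

  quadrangle : Fin n × Fin n → List (Fin n × Fin n)
  quadrangle = orbitPrefix 4

  quadrangle-pred : ∀ {r y} → Dart G r → Quadrangular r → Dart G y → φ y ∈ quadrangle r → y ∈ quadrangle r
  quadrangle-pred dr q dy (here φy≡r) =
    there (there (there (here (φ-injective dy (iter-dart 3 dr) (trans φy≡r (sym q))))))
  quadrangle-pred dr q dy (there (here φy≡φr))                 = here (φ-injective dy dr φy≡φr)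
  quadrangle-pred dr q dy (there (there (here φy≡φ²r)))        = there (here (φ-injective dy (iter-dart 1 dr) φy≡φ²r))
  quadrangle-pred dr q dy (there (there (there (here φy≡φ³r)))) =
    there (there (here (φ-injective dy (iter-dart 2 dr) φy≡φ³r)))

module Faces {G : Graph} (ρ : RotationSystem G) (bipartite : Bipartite G) (δ : MinDegree≥3 G) where
  open Graph G
  open GraphProperties G
  open RotationSystem ρ
  open RotationSystemProperties ρ

  private
    colour = proj₁ bipartite
    colour-proper = proj₂ bipartite
    neighbour = proj₁ δ
    third = proj₂ δ

  σ-no-fixpoint : ∀ {v u} → Adj G v u → σ v u ≢ u
  σ-no-fixpoint {v} {u} vu fixed =
    let w , vw , w≢u , _ = third vu vu
        k , reach = σ-cycle v u w vu vw
    in w≢u (trans (sym reach) (iter-fixed (σ v) fixed k))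

  colour-iter : ∀ {x} → Dart G x → ∀ k → colour (proj₁ (iter φ k x)) ≡ iter not k (colour (proj₁ x))
  colour-iter dx zero    = refl
  colour-iter dx (suc k) =
    trans (¬-not (colour-proper _ _ (Adj-sym (iter-dart k dx)))) (cong not (colour-iter dx k))

  parity-obstruction : ∀ k {x} → Dart G x → (∀ b → iter not k b ≢ b) → iter φ k x ≢ x
  parity-obstruction k {x} dx flips eq =
    flips (colour (proj₁ x)) (trans (sym (colour-iter dx k)) (cong (colour ∘ proj₁) eq))

  short-period : ∀ {x} → Dart G x → ∀ d → 0 < d → d < 6 → iter φ d x ≡ x → d ≡ 4
  short-period dx 1 _ _ eq = ⊥-elim (parity-obstruction 1 dx (λ { true () ; false () }) eq)
  short-period dx 2 _ _ eq = ⊥-elim (σ-no-fixpoint (Adj-sym dx) (cong proj₁ eq))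
  short-period dx 3 _ _ eq = ⊥-elim (parity-obstruction 3 dx (λ { true () ; false () }) eq)
  short-period dx 4 _ _ eq = refl
  short-period dx 5 _ _ eq = ⊥-elim (parity-obstruction 5 dx (λ { true () ; false () }) eq)
  short-period dx (suc (suc (suc (suc (suc (suc _)))))) _ (s≤s (s≤s (s≤s (s≤s (s≤s (s≤s ())))))) _

  repeated-iterate : ∀ {r i j} → Dart G r → i < j → j < 6 → iter φ i r ≡ iter φ j r → Quadrangular r × 4 ≤ j
  repeated-iterate {r} {i} {j} dr i<j j<6 eq =
    quadrangular-backwards i dr (subst (λ e → iter φ e (iter φ i r) ≡ iter φ i r) d≡4 period) ,
    subst (_≤ j) d≡4 (m∸n≤m j i)
    where
    period : iter φ (j ∸ i) (iter φ i r) ≡ iter φ i r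
    period = trans (sym (iter-+ φ (j ∸ i) i r)) (trans (cong (λ m → iter φ m r) (m∸n+n≡m (<⇒≤ i<j))) (sym eq))
    d≡4 : j ∸ i ≡ 4
    d≡4 = short-period (iter-dart i dr) (j ∸ i) (m<n⇒0<n∸m i<j) (≤-<-trans (m∸n≤m j i) j<6) period

  -- min(|f|, 6) darts of the face f of r
  leadingDarts : Fin n × Fin n → List (Fin n × Fin n)
  leadingDarts r = orbitPrefix (if does (quadrangular? r) then 4 else 6) r

  length-leadingDarts : ∀ r → length (leadingDarts r) ≡ (if does (quadrangular? r) then 4 else 6)
  length-leadingDarts r = length-orbitPrefix _ r

  leadingDarts-unique : ∀ {r} → Dart G r → Unique (leadingDarts r)
  leadingDarts-unique {r} dr with quadrangular? r
  ... | yes _ = applyUpTo⁺₁ _ 4 λ i<j j<4 eq →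
    <⇒≱ j<4 (proj₂ (repeated-iterate dr i<j (≤-trans j<4 (m≤m+n 4 2)) eq))
  ... | no ¬q = applyUpTo⁺₁ _ 6 λ i<j j<6 eq → ¬q (proj₁ (repeated-iterate dr i<j j<6 eq))

  leadingDarts-count : ∀ rs →
    length (concatMap leadingDarts rs) + 2 * length (filter quadrangular? rs) ≡ 6 * length rs
  leadingDarts-count [] = refl
  leadingDarts-count (r ∷ rs) = begin
    length (leadingDarts r ++ rest) + 2 * length (filter quadrangular? (r ∷ rs))
      ≡⟨ cong (_+ 2 * length (filter quadrangular? (r ∷ rs)))
              (trans (length-++ (leadingDarts r)) (cong (_+ length rest) (length-leadingDarts r))) ⟩
    (if does (quadrangular? r) then 4 else 6) + length rest + 2 * length (filter quadrangular? (r ∷ rs))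
      ≡⟨ step ⟩
    6 + (length rest + 2 * length (filter quadrangular? rs))
      ≡⟨ cong (6 +_) (leadingDarts-count rs) ⟩
    6 + 6 * length rs
      ≡⟨ *-suc 6 (length rs) ⟨
    6 * length (r ∷ rs) ∎
    where
    open ≡-Reasoning
    rest = concatMap leadingDarts rs
    step : (if does (quadrangular? r) then 4 else 6) + length rest + 2 * length (filter quadrangular? (r ∷ rs))
         ≡ 6 + (length rest + 2 * length (filter quadrangular? rs))
    step with quadrangular? r
    ... | yes _ = arith (length rest) (length (filter quadrangular? rs))
      where
      arith : ∀ l q → 4 + l + 2 * suc q ≡ 6 + (l + 2 * q)
      arith = solve-∀
    ... | no _ = +-assoc 6 (length rest) _

  leadingDarts-bound : ∀ {rs} → All (Dart G) rs → DistinctFaces rs →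
                       length (concatMap leadingDarts rs) ≤ nDarts G
  leadingDarts-bound {rs} drs distinct =
    subst (length (concatMap leadingDarts rs) ≤_) length-darts (length-mono-⊆ unique ⊆darts)
    where
    unique : Unique (concatMap leadingDarts rs)
    unique = Unique.concat⁺ (All.map⁺ (All.map leadingDarts-unique drs))
      (AllPairs.map⁺ (AllPairs-mapWith-All (λ dr dr′ ¬same (x∈ , x∈′) → ¬same (orbitPrefixes-meet dr dr′ x∈ x∈′))
                                           drs distinct))
    ⊆darts : ∀ {x} → x ∈ concatMap leadingDarts rs → x ∈ darts
    ⊆darts x∈ = let dr , x∈r = All.lookupAny drs (∈-concatMap⁻ leadingDarts x∈) in
      darts-complete (orbitPrefix-darts dr x∈r)

  faces-bound : ∀ {rs} → All (Dart G) rs → DistinctFaces rs →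
                6 * length rs ≤ nDarts G + 2 * length (filter quadrangular? rs)
  faces-bound {rs} drs distinct = begin
    6 * length rs
      ≡⟨ leadingDarts-count rs ⟨
    length (concatMap leadingDarts rs) + 2 * length (filter quadrangular? rs)
      ≤⟨ +-monoˡ-≤ _ (leadingDarts-bound drs distinct) ⟩
    nDarts G + 2 * length (filter quadrangular? rs) ∎
    where open ≤-Reasoning

  three≤degree : ∀ v → 3 ≤ degree v
  three≤degree v =
    let y₀ , vy₀ = neighbour v
        y₁ , vy₁ , y₁≢y₀ , _ = third vy₀ vy₀
        y₂ , vy₂ , y₂≢y₀ , y₂≢y₁ = third vy₀ vy₁
    in distinct-neighbours≤degree ((≢-sym y₁≢y₀ ∷ ≢-sym y₂≢y₀ ∷ []) ∷ (≢-sym y₂≢y₁ ∷ []) ∷ [] ∷ [])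
                                  (vy₀ ∷ vy₁ ∷ vy₂ ∷ [])

  quadrangles-lower-bound : ∀ {F nD Q T} → 2 * n + 2 * F ≡ nD + 4 → 6 * F ≤ nD + 2 * Q → 3 * n + T ≤ nD → 6 + T ≤ Q
  quadrangles-lower-bound {F} {nD} {Q} {T} euler faces degrees =
    *-cancelˡ-≤ 2 (+-cancelˡ-≤ (3 * nD) _ _ (begin
      3 * nD + 2 * (6 + T)           ≡⟨ e₁ nD T ⟩
      3 * (nD + 4) + 2 * T           ≡⟨ cong (λ k → 3 * k + 2 * T) euler ⟨
      3 * (2 * n + 2 * F) + 2 * T    ≡⟨ e₂ n F T ⟩
      2 * (3 * n + T) + 6 * F        ≤⟨ +-mono-≤ (*-monoʳ-≤ 2 degrees) faces ⟩
      2 * nD + (nD + 2 * Q)          ≡⟨ e₃ nD Q ⟩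
      3 * nD + 2 * Q                 ∎))
    where
    open ≤-Reasoning
    e₁ : ∀ d t → 3 * d + 2 * (6 + t) ≡ 3 * (d + 4) + 2 * t
    e₁ = solve-∀
    e₂ : ∀ v f t → 3 * (2 * v + 2 * f) + 2 * t ≡ 2 * (3 * v + t) + 6 * f
    e₂ = solve-∀
    e₃ : ∀ d q → 2 * d + (d + 2 * q) ≡ 3 * d + 2 * q
    e₃ = solve-∀

  -- Quadrangles sharing an edge with a 4-cycle

  neighbours-at-degree-three : ∀ {x p q z} → degree x ≤ 3 → Adj G x p → Adj G x q → Adj G x z →
                               p ≢ q → z ≢ p → z ≢ q → ∀ {w} → Adj G x w → w ≡ p ⊎ w ≡ q ⊎ w ≡ z
  neighbours-at-degree-three {p = p} {q} {z} deg≤3 xp xq xz p≢q z≢p z≢q {w} xw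
    with w Fin.≟ p | w Fin.≟ q | w Fin.≟ z
  ... | yes w≡p | _       | _       = inj₁ w≡p
  ... | no _    | yes w≡q | _       = inj₂ (inj₁ w≡q)
  ... | no _    | no _    | yes w≡z = inj₂ (inj₂ w≡z)
  ... | no w≢p  | no w≢q  | no w≢z  = ⊥-elim (≤⇒≯ deg≤3 (distinct-neighbours≤degree
        ((p≢q ∷ ≢-sym z≢p ∷ ≢-sym w≢p ∷ []) ∷ (≢-sym z≢q ∷ ≢-sym w≢q ∷ []) ∷ (≢-sym w≢z ∷ []) ∷ [] ∷ [])
        (xp ∷ xq ∷ xz ∷ xw ∷ [])))

  rotation-at-degree-three : ∀ {x p q} → degree x ≤ 3 → Adj G x p → Adj G x q → p ≢ q → σ x p ≡ q ⊎ σ x q ≡ p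
  rotation-at-degree-three {x} {p} {q} deg≤3 xp xq p≢q =
    case only (σ-adj x q xq) ,′ only (σ-adj x p xp) of λ where
      (inj₁ σq≡p , _)                        → inj₂ σq≡p
      (inj₂ (inj₁ σq≡q) , _)                 → ⊥-elim (σ-no-fixpoint xq σq≡q)
      (_ , inj₁ σp≡p)                        → ⊥-elim (σ-no-fixpoint xp σp≡p)
      (_ , inj₂ (inj₁ σp≡q))                 → inj₁ σp≡q
      (inj₂ (inj₂ σq≡z) , inj₂ (inj₂ σp≡z)) → ⊥-elim (p≢q (σ-inj x p q xp xq (trans σp≡z (sym σq≡z))))
    where
    z = proj₁ (third xp xq)
    only : ∀ {w} → Adj G x w → w ≡ p ⊎ w ≡ q ⊎ w ≡ z
    only = let _ , xz , z≢p , z≢q = third xp xq in neighbours-at-degree-three deg≤3 xp xq xz p≢q z≢p z≢q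

  bit : Bool → ℕ
  bit b = if b then 1 else 0

  link : Fin n × Fin n → Fin n × Fin n → ℕ
  link y z = bit (does (φ y ≟ᵈ z))

  link≡1 : ∀ {y z} → φ y ≡ z → link y z ≡ 1
  link≡1 {y} {z} φy≡z = cong bit (dec-true (φ y ≟ᵈ z) φy≡z)

  vertex-links : ∀ {x p q} → Adj G x p → Adj G x q → p ≢ q →
                 1 ≤ excess x + link (p , x) (x , q) + link (q , x) (x , p)
  vertex-links {x} {p} {q} xp xq p≢q with degree x ≤? 3
  ... | no deg≰3 = ≤-trans (m<n⇒0<n∸m (≰⇒> deg≰3)) (≤-trans (m≤m+n _ _) (m≤m+n _ _))
  ... | yes deg≤3 with rotation-at-degree-three deg≤3 xp xq p≢q
  ...   | inj₁ σp≡q = subst (λ l → 1 ≤ excess x + l + link (q , x) (x , p)) (sym (link≡1 (cong (x ,_) σp≡q)))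
                        (≤-trans (m≤n+m 1 (excess x)) (m≤m+n _ _))
  ...   | inj₂ σq≡p = subst (λ l → 1 ≤ excess x + link (p , x) (x , q) + l) (sym (link≡1 (cong (x ,_) σq≡p)))
                        (m≤n+m 1 _)

  -- Cut ys into maximal runs y, φ y, φ² y, …; segmentStarts ys lists the first dart of each run.
  -- Quadrangles are closed under φ⁻¹, so a quadrangle meeting ys meets a run start.
  segmentStartsAfter : Fin n × Fin n → List (Fin n × Fin n) → List (Fin n × Fin n)
  segmentStartsAfter p []       = []
  segmentStartsAfter p (y ∷ ys) =
    if does (φ p ≟ᵈ y) then segmentStartsAfter y ys else y ∷ segmentStartsAfter y ys

  segmentStarts : List (Fin n × Fin n) → List (Fin n × Fin n)
  segmentStarts []       = []
  segmentStarts (y ∷ ys) = y ∷ segmentStartsAfter y ys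

  linksAfter : Fin n × Fin n → List (Fin n × Fin n) → ℕ
  linksAfter p []       = 0
  linksAfter p (y ∷ ys) = link p y + linksAfter y ys

  linkCount : List (Fin n × Fin n) → ℕ
  linkCount []       = 0
  linkCount (y ∷ ys) = linksAfter y ys

  length-segmentStartsAfter : ∀ p ys → length (segmentStartsAfter p ys) + linksAfter p ys ≡ length ys
  length-segmentStartsAfter p []       = refl
  length-segmentStartsAfter p (y ∷ ys) with φ p ≟ᵈ y
  ... | yes _ = trans (+-suc _ _) (cong suc (length-segmentStartsAfter y ys))
  ... | no _  = cong suc (length-segmentStartsAfter y ys)

  length-segmentStarts : ∀ ys → length (segmentStarts ys) + linkCount ys ≡ length ys
  length-segmentStarts []       = refl
  length-segmentStarts (y ∷ ys) = cong suc (length-segmentStartsAfter y ys)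

  Touches : List (Fin n × Fin n) → Fin n × Fin n → Set
  Touches ys r = Any (_∈ quadrangle r) ys

  module _ {r} (face : QuadrangularFace r) where
    private
      dr = proj₁ face
      quad = proj₂ face

      hit-at-head : ∀ {p y} ys → Dart G p → y ∈ quadrangle r →
                    p ∈ quadrangle r ⊎ Touches (segmentStartsAfter p (y ∷ ys)) r
      hit-at-head {p} {y} ys dp y∈ with φ p ≟ᵈ y
      ... | yes φp≡y = inj₁ (quadrangle-pred dr quad dp (subst (_∈ quadrangle r) (sym φp≡y) y∈))
      ... | no _     = inj₂ (here y∈)

      hit-after-head : ∀ {p y} ys → Touches (segmentStartsAfter y ys) r → Touches (segmentStartsAfter p (y ∷ ys)) r
      hit-after-head {p} {y} ys hit with φ p ≟ᵈ y
      ... | yes _ = hit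
      ... | no _  = there hit

    touches-segmentStartsAfter : ∀ {p ys} → Dart G p → All (Dart G) ys → Touches ys r →
                                 p ∈ quadrangle r ⊎ Touches (segmentStartsAfter p ys) r
    touches-segmentStartsAfter {ys = _ ∷ ys} dp (dy ∷ dys) (here y∈) = hit-at-head ys dp y∈
    touches-segmentStartsAfter {p} {y ∷ ys} dp (dy ∷ dys) (there hit) with touches-segmentStartsAfter dy dys hit
    ... | inj₁ y∈   = hit-at-head ys dp y∈
    ... | inj₂ hit′ = inj₂ (hit-after-head {p} ys hit′)

    touches-segmentStarts : ∀ {ys} → All (Dart G) ys → Touches ys r → Touches (segmentStarts ys) r
    touches-segmentStarts (dy ∷ dys) (here y∈) = here y∈
    touches-segmentStarts (dy ∷ dys) (there hit) with touches-segmentStartsAfter dy dys hit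
    ... | inj₁ y∈   = here y∈
    ... | inj₂ hit′ = there hit′

  chain-bound : ∀ {ys rs} → All (Dart G) ys → All (λ r → QuadrangularFace r × Touches ys r) rs → DistinctFaces rs →
                length rs + linkCount ys ≤ length ys
  chain-bound {ys} {rs} dys touching distinct = begin
    length rs + linkCount ys                 ≤⟨ +-monoˡ-≤ (linkCount ys) (length≤-disjoint-witnesses disjoint hits) ⟩
    length (segmentStarts ys) + linkCount ys ≡⟨ length-segmentStarts ys ⟩
    length ys                                ∎
    where
    open ≤-Reasoning
    disjoint : AllPairs (λ r r′ → ∀ {y} → y ∈ quadrangle r → y ∈ quadrangle r′ → ⊥) rs
    disjoint = AllPairs-mapWith-All
      (λ ((dr , _) , _) ((dr′ , _) , _) ¬same y∈ y∈′ → ¬same (orbitPrefixes-meet dr dr′ y∈ y∈′))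
      touching distinct
    hits : All (λ r → Touches (segmentStarts ys) r) rs
    hits = All.map (λ (face , touch) → touches-segmentStarts face dys touch) touching

  cyclicLinks : (y₀ y₁ y₂ y₃ : Fin n × Fin n) → ℕ
  cyclicLinks y₀ y₁ y₂ y₃ = linkCount (y₀ ∷ y₁ ∷ y₂ ∷ y₃ ∷ y₀ ∷ [])

  private
    rotate : ∀ {P : Fin n × Fin n → Set} {y₀ y₁ y₂ y₃} → Any P (y₀ ∷ y₁ ∷ y₂ ∷ y₃ ∷ []) → Any P (y₁ ∷ y₂ ∷ y₃ ∷ y₀ ∷ [])
    rotate (here p)                         = there (there (there (here p)))
    rotate (there (here p))                 = here p
    rotate (there (there (here p)))         = there (here p)
    rotate (there (there (there (here p)))) = there (there (here p))

    cyclic-arith : ∀ m b₀ b₁ b₂ b₃ →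
      m + (bit b₀ + (bit b₁ + (bit b₂ + 0))) ≤ 4 → m + (bit b₁ + (bit b₂ + (bit b₃ + 0))) ≤ 4 →
      m + (bit b₂ + (bit b₃ + (bit b₀ + 0))) ≤ 4 → m + (bit b₃ + (bit b₀ + (bit b₁ + 0))) ≤ 4 →
      m + (bit b₀ + (bit b₁ + (bit b₂ + (bit b₃ + 0)))) ≤ 4 ⊎ m ≤ 1
    cyclic-arith m b₀    b₁    b₂    false h₀ _  _  _  = inj₁ h₀
    cyclic-arith m false b₁    b₂    true  _  h₁ _  _  = inj₁ h₁
    cyclic-arith m true  false false true  _  _  h₂ _  = inj₁ h₂
    cyclic-arith m true  false true  true  _  _  h₂ _  = inj₁ h₂
    cyclic-arith m true  true  false true  _  _  _  h₃ = inj₁ h₃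
    cyclic-arith m true  true  true  true  h₀ _  _  _  = inj₂ (+-cancelʳ-≤ 3 m 1 h₀)

  -- chain-bound ignores the link y₃ → y₀; rotating makes it ignore a missing link, if any.
  cyclic-bound : ∀ {y₀ y₁ y₂ y₃ rs} → All (Dart G) (y₀ ∷ y₁ ∷ y₂ ∷ y₃ ∷ []) →
                 All (λ r → QuadrangularFace r × Touches (y₀ ∷ y₁ ∷ y₂ ∷ y₃ ∷ []) r) rs → DistinctFaces rs →
                 length rs + cyclicLinks y₀ y₁ y₂ y₃ ≤ 4 ⊎ length rs ≤ 1
  cyclic-bound {y₀} {y₁} {y₂} {y₃} {rs} (d₀ ∷ d₁ ∷ d₂ ∷ d₃ ∷ []) touching distinct =
    cyclic-arith (length rs) (does (φ y₀ ≟ᵈ y₁)) (does (φ y₁ ≟ᵈ y₂)) (does (φ y₂ ≟ᵈ y₃)) (does (φ y₃ ≟ᵈ y₀))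
      (chain-bound (d₀ ∷ d₁ ∷ d₂ ∷ d₃ ∷ []) touching distinct)
      (chain-bound (d₁ ∷ d₂ ∷ d₃ ∷ d₀ ∷ []) touching₁ distinct)
      (chain-bound (d₂ ∷ d₃ ∷ d₀ ∷ d₁ ∷ []) touching₂ distinct)
      (chain-bound (d₃ ∷ d₀ ∷ d₁ ∷ d₂ ∷ []) touching₃ distinct)
    where
    touching₁ = All.map (Product.map₂ rotate) touching
    touching₂ = All.map (Product.map₂ rotate) touching₁
    touching₃ = All.map (Product.map₂ rotate) touching₂

  module FaceCycle {r} (face : QuadrangularFace r) where
    private
      dr = proj₁ face
      quad = proj₂ face

    corner : ℕ → Fin n
    corner i = proj₁ (iter φ i r)

    closing-edge : Adj G (corner 3) (corner 0)
    closing-edge = subst (Adj G (corner 3)) (cong proj₁ quad) (iter-dart 3 dr)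

    cycle : Cycle4 G
    cycle = record
      { a = corner 0 ; b = corner 1 ; c = corner 2 ; d = corner 3
      ; ab = Adj⇒≢ dr
      ; ac = ≢-sym (σ-no-fixpoint (Adj-sym dr))
      ; ad = ≢-sym (Adj⇒≢ closing-edge)
      ; bc = Adj⇒≢ (iter-dart 1 dr)
      ; bd = ≢-sym (σ-no-fixpoint (Adj-sym (iter-dart 1 dr)))
      ; cd = Adj⇒≢ (iter-dart 2 dr)
      ; e₁ = dr ; e₂ = iter-dart 1 dr ; e₃ = iter-dart 2 dr ; e₄ = closing-edge
      }

    forwardDarts-cycle : forwardDarts cycle ≡ quadrangle r
    forwardDarts-cycle = cong (λ w → r ∷ φ r ∷ iter φ 2 r ∷ (corner 3 , w) ∷ []) (sym (cong proj₁ quad))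

  module _ (C : Cycle4 G) where
    open Cycle4 C
    open import Data.List.Membership.DecPropositional _≟ᵈ_ using (_∈?_)

    excess-at-corners : ℕ
    excess-at-corners = sum (map excess (corners C))

    TouchesCycle : Fin n × Fin n → Set
    TouchesCycle r = Touches (forwardDarts C) r ⊎ Touches (backwardDarts C) r

    touches? : ∀ ys r → Dec (Touches ys r)
    touches? ys r = Any.any? (_∈? quadrangle r) ys

    touchesCycle? : ∀ r → Dec (TouchesCycle r)
    touchesCycle? r = touches? (forwardDarts C) r ⊎-dec touches? (backwardDarts C) r

    touchesCycle-at : ∀ {r x} → x ∈ quadrangle r → x ∈ forwardDarts C ⊎ x ∈ backwardDarts C → TouchesCycle r
    touchesCycle-at x∈r = Sum.map (λ x∈ → lose x∈ x∈r) (λ x∈ → lose x∈ x∈r)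

    faceCycle-disjoint : ∀ {r} (face : QuadrangularFace r) → ¬ TouchesCycle r → EdgeDisjoint G C (FaceCycle.cycle face)
    faceCycle-disjoint face ¬touches u v edge edge′ with EdgeOf⇒dart (FaceCycle.cycle face) edge′
    ... | inj₁ uv∈face = ¬touches (touchesCycle-at
      (subst ((u , v) ∈_) (FaceCycle.forwardDarts-cycle face) uv∈face)
      (EdgeOf⇒dart C edge))
    ... | inj₂ vu∈face = ¬touches (touchesCycle-at
      (subst ((v , u) ∈_) (FaceCycle.forwardDarts-cycle face) (reverse-backwardDart (FaceCycle.cycle face) vu∈face))
      (Sum.swap (Sum.map (reverse-forwardDart C) (reverse-backwardDart C) (EdgeOf⇒dart C edge))))

    corner-links : 4 ≤ excess-at-corners + cyclicLinks (a , b) (b , c) (c , d) (d , a)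
                                         + cyclicLinks (b , a) (a , d) (d , c) (c , b)
    corner-links = subst (4 ≤_) (rearrange (excess a) (excess b) (excess c) (excess d) _ _ _ _ _ _ _ _)
      (+-mono-≤ (+-mono-≤ (+-mono-≤ (vertex-links (Adj-sym e₄) e₁ (≢-sym bd)) (vertex-links (Adj-sym e₁) e₂ ac))
                          (vertex-links (Adj-sym e₂) e₃ bd))
                (vertex-links (Adj-sym e₃) e₄ (≢-sym ac)))
      where
      rearrange : ∀ xa xb xc xd fa fb fc fd ga gb gc gd →
        (xa + fa + ga) + (xb + fb + gb) + (xc + fc + gc) + (xd + fd + gd) ≡
        (xa + (xb + (xc + (xd + 0)))) + (fb + (fc + (fd + (fa + 0)))) + (ga + (gd + (gc + (gb + 0))))
      rearrange = solve-∀

    private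
      bound⇒≤4 : ∀ {m s} → m + s ≤ 4 ⊎ m ≤ 1 → m ≤ 4
      bound⇒≤4 (inj₁ m+s≤4) = ≤-trans (m≤m+n _ _) m+s≤4
      bound⇒≤4 (inj₂ m≤1)   = ≤-trans m≤1 (s≤s z≤n)

      touching-arith : ∀ {mF mB t sF sB} → mF + sF ≤ 4 ⊎ mF ≤ 1 → mB + sB ≤ 4 ⊎ mB ≤ 1 → 4 ≤ t + sF + sB →
                       mF + mB ≤ 5 + t
      touching-arith {t = t} (inj₂ mF≤1) boundB _ = ≤-trans (+-mono-≤ mF≤1 (bound⇒≤4 boundB)) (m≤m+n 5 t)
      touching-arith {t = t} (inj₁ boundF) (inj₂ mB≤1) _ =
        ≤-trans (+-mono-≤ (bound⇒≤4 (inj₁ boundF)) mB≤1) (m≤m+n 5 t)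
      touching-arith {mF} {mB} {t} {sF} {sB} (inj₁ boundF) (inj₁ boundB) links =
        ≤-trans (+-cancelʳ-≤ 4 (mF + mB) (4 + t) (begin
          mF + mB + 4                  ≤⟨ +-monoʳ-≤ (mF + mB) links ⟩
          mF + mB + (t + sF + sB)      ≡⟨ shuffle mF mB t sF sB ⟩
          t + ((mF + sF) + (mB + sB))  ≤⟨ +-monoʳ-≤ t (+-mono-≤ boundF boundB) ⟩
          t + 8                        ≡⟨ +-comm t 8 ⟩
          8 + t                        ≡⟨ cong (4 +_) (+-comm 4 t) ⟩
          4 + t + 4                    ∎)) (n≤1+n _)
        where
        open ≤-Reasoning
        shuffle : ∀ a b c d e → a + b + (c + d + e) ≡ c + ((a + d) + (b + e))
        shuffle = solve-∀

    touching-bound : ∀ {qs} → All QuadrangularFace qs → DistinctFaces qs → All TouchesCycle qs →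
                     length qs ≤ 5 + excess-at-corners
    touching-bound {qs} faces distinct touching = begin
      length qs                                        ≡⟨ length-filter-∁ touchesF? qs ⟨
      length forwardTouching + length backwardTouching ≤⟨ touching-arith boundF boundB corner-links ⟩
      5 + excess-at-corners                            ∎
      where
      open ≤-Reasoning
      touchesF? = touches? (forwardDarts C)
      forwardTouching = filter touchesF? qs
      backwardTouching = filter (¬? ∘ touchesF?) qs
      touchesB : All (Touches (backwardDarts C)) backwardTouching
      touchesB = All.zipWith (λ (touch , ¬touchF) → Sum.[ ⊥-elim ∘ ¬touchF , id ] touch)
                             (All.filter⁺ (¬? ∘ touchesF?) touching , All.all-filter (¬? ∘ touchesF?) qs)
      boundF = cyclic-bound (forwardDarts-darts C)
        (All.zip (All.filter⁺ touchesF? faces , All.all-filter touchesF? qs))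
        (AllPairs.filter⁺ touchesF? distinct)
      boundB = cyclic-bound (backwardDarts-darts C)
        (All.zip (All.filter⁺ (¬? ∘ touchesF?) faces , touchesB))
        (AllPairs.filter⁺ (¬? ∘ touchesF?) distinct)

    touching-quadrangles-impossible : ∀ {reps} → FaceRepresentatives G ρ reps →
      2 * n + 2 * length reps ≡ nDarts G + 4 → All (λ r → Quadrangular r → TouchesCycle r) reps → ⊥
    touching-quadrangles-impossible {reps} (reps-darts , _ , distinct) euler quadrangular⇒touches =
      1+n≰n (≤-trans
        (quadrangles-lower-bound {length reps} euler (faces-bound reps-darts distinct)
                                 (degree-sum three≤degree (corners-unique C)))
        (touching-bound faces (AllPairs.filter⁺ quadrangular? distinct) touching))
      where
      faces : All QuadrangularFace (filter quadrangular? reps)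
      faces = All.zip (All.filter⁺ quadrangular? reps-darts , All.all-filter quadrangular? reps)
      touching : All TouchesCycle (filter quadrangular? reps)
      touching = All.zipWith (λ (quad⇒touches , quad) → quad⇒touches quad)
        (All.filter⁺ quadrangular? quadrangular⇒touches , All.all-filter quadrangular? reps)

    disjoint-4-cycle : ∀ {reps} → FaceRepresentatives G ρ reps → 2 * n + 2 * length reps ≡ nDarts G + 4 →
                       Σ (Cycle4 G) (EdgeDisjoint G C)
    disjoint-4-cycle {reps} faceReps euler
      with Any.any? (λ r → quadrangular? r ×-dec ¬? (touchesCycle? r)) reps
    ... | yes found =
      let _ , r∈ , quad , ¬touches = find found
          face = All.lookup (proj₁ faceReps) r∈ , quad
      in FaceCycle.cycle face , faceCycle-disjoint face ¬touches
    ... | no none = ⊥-elim (touching-quadrangles-impossible faceReps euler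
      (All.map (λ ¬found quad → decidable-stable (touchesCycle? _) (¬found ∘ (quad ,_))) (¬Any⇒All¬ reps none)))

lemma3p3 : (B : Graph) → Planar B → Brace B → ¬ IsC4 B →
    (C : Cycle4 B) → Σ (Cycle4 B) λ C' → EdgeDisjoint B C C'
lemma3p3 B (_ , ρ , reps , faceRepresentatives , euler) (bipartite , matchingCovered , tight) notC4 C =
  Faces.disjoint-4-cycle ρ bipartite minDegree C faceRepresentatives euler
  where
  minDegree : MinDegree≥3 B
  minDegree = brace⇒minDegree≥3 matchingCovered tight (¬IsC4⇒atLeastFiveVertices bipartite C notC4)
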